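{- Every weak Carmichael number is odd. Furthermore, an odd composite positive integer $n$ is a weak Carmichael number if and only if $$2\sum_{i=1}^{\varphi(n)/2} r_i^{\,n-1}\equiv \varphi(n)\pmod{n},$$ where $r_1<r_2<\cdots<r_{\varphi(n)}$ are all the integers $r$ with $1\le r\le n-1$ and $\gcd(r,n)=1$.
   Context: A composite positive integer $n$ is called a weak Carmichael number if $\sum_{1\le k\le n-1,\ \gcd(k,n)=1} k^{n-1}\equiv \varphi(n)\pmod{n}$, where $\varphi$ is Euler's totient function. -}

module Defs where

open import Data.Nat using (ℕ; suc; _∸_; _^_; _*_; _/_)
open import Data.Nat.GCD using (gcd)
open import Data.Nat.Primality using (Composite)
open import Data.Nat.Properties using (_≟_)
open import Data.List using (List; filter; applyUpTo; length; map; take)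
open import Data.Nat.ListAction using (sum)
open import Data.Product using (_×_)
open import Data.Integer as ℤ using (ℤ; +_)
open import Data.Integer.Divisibility using () renaming (_∣_ to _∣ℤ_)

_≡_[mod_] : ℕ → ℕ → ℕ → Set
a ≡ b [mod n ] = (+ n) ∣ℤ ((+ a) ℤ.- (+ b))

reducedResidues : ℕ → List ℕ
reducedResidues n = filter (λ r → gcd r n ≟ 1) (applyUpTo suc (n ∸ 1))

-- Euler's totient (for n ≥ 2: the number of 1 ≤ k ≤ n-1 coprime to n).
φ : ℕ → ℕ
φ n = length (reducedResidues n)

WeakCarmichael : ℕ → Set
WeakCarmichael n =
  Composite n × (sum (map (λ k → k ^ (n ∸ 1)) (reducedResidues n)) ≡ φ n [mod n ])

halfSum : ℕ → ℕ
halfSum n = 2 * sum (map (λ r → r ^ (n ∸ 1)) (take (φ n / 2) (reducedResidues n)))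

module Submission where

-- Pair each reduced residue r < n/2 with n - r, which is again a reduced
-- residue and is ≡ -r (mod n).  For odd n the exponent n - 1 is even, so both
-- members of a pair contribute r^(n-1) and the whole sum is twice the sum over the
-- first φ(n)/2 residues.  For even n ≥ 4 the exponent is odd, the pairs cancel and
-- the sum is ≡ 0 (the unpaired middle value n/2 is not coprime to n); the weak
-- Carmichael condition would then force n ∣ φ(n), impossible since 0 < φ(n) < n.

open import Defs
open import Data.Nat as ℕ using (ℕ; zero; suc; _+_; _*_; _∸_; _^_; _/_; _≤_; _<_; s≤s; z<s; >-nonZero)
open import Data.Nat.Properties
  using (+-suc; +-comm; +-identityʳ; *-comm; m≤n+m; m≤m+n; n≤1+n; ≤-trans; ≤-reflexive; <⇒≱;
         m∸n+n≡m; m+[n∸m]≡n; +-commutativeSemigroup)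
open import Algebra.Properties.CommutativeSemigroup +-commutativeSemigroup using (interchange)
open import Data.Nat.DivMod using (m*n/n≡m)
open import Data.Nat.Divisibility using (_∣_; divides; ∣-refl; m∣m*n; ∣m∣n⇒∣m+n; ∣m+n∣m⇒∣n; ∣1⇒≡1; ∣⇒≤)
open import Data.Nat.GCD using (gcd; gcd-GCD; gcd-comm; gcd-zeroˡ; module GCD)
open import Data.Nat.Primality using (Composite; ¬composite[0]; prime[2]; prime⇒¬composite)
open import Data.Nat.ListAction using (sum)
open import Data.Nat.ListAction.Properties using (sum-++; sum-↭)
open import Data.List using (List; []; _∷_; _++_; [_]; map; filter; length; take; applyUpTo; applyDownFrom; reverse)
open import Data.List.Properties
  using (map-++; map-∘; map-applyUpTo; length-++; length-map; length-filter; length-applyUpTo;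
         reverse-applyUpTo; applyUpTo-∷ʳ; filter-++; filter-accept; filter-reject; ++-identityʳ)
open import Data.List.Relation.Unary.All as All using (All; []; _∷_)
open import Data.List.Relation.Unary.All.Properties as All using (filter⁺; applyUpTo⁺₁)
open import Data.List.Relation.Binary.Permutation.Propositional using (_↭_; ↭-sym; ↭-trans; ↭-reflexive)
open import Data.List.Relation.Binary.Permutation.Propositional.Properties
  using (↭-reverse; filter-↭; map⁺; ↭-length)
open import Data.Integer as ℤ using (+_; -_)
open import Data.Integer.Properties using (pos-*; pos-+; +-inverseʳ; *-zeroˡ; neg-involutive; neg-distribˡ-*)
open import Data.Integer.Divisibility.Signed as ℤ using (∣ᵤ⇒∣; ∣⇒∣ᵤ)
open import Data.Integer.Tactic.RingSolver using (solve-∀)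
open import Data.Product using (_×_; _,_; proj₁)
open import Function using (_∘_)
open import Function.Bundles using (_⇔_; mk⇔; Equivalence)
open import Relation.Nullary using (¬_; Dec; yes; no; contradiction)
open import Relation.Binary.PropositionalEquality
  using (_≡_; _≢_; refl; sym; trans; cong; cong₂; subst; subst₂; module ≡-Reasoning)

pos-^ : ∀ m e → + (m ^ e) ≡ (+ m) ℤ.^ e
pos-^ m zero    = refl
pos-^ m (suc e) = trans (pos-* m (m ^ e)) (cong (ℤ._*_ (+ m)) (pos-^ m e))

neg-^-even : ∀ i k → (- i) ℤ.^ (k + k) ≡ i ℤ.^ (k + k)
neg-^-even i zero    = refl
neg-^-even i (suc k) rewrite +-suc k k | neg-^-even i k = square-neg i (i ℤ.^ (k + k))
  where
  square-neg : ∀ i x → (- i) ℤ.* ((- i) ℤ.* x) ≡ i ℤ.* (i ℤ.* x)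
  square-neg = solve-∀

neg-^-odd : ∀ i k → (- i) ℤ.^ suc (k + k) ≡ - i ℤ.^ suc (k + k)
neg-^-odd i k = trans (cong (ℤ._*_ (- i)) (neg-^-even i k)) (sym (neg-distribˡ-* i (i ℤ.^ (k + k))))

i-j∣i^e-j^e : ∀ i j e → i ℤ.- j ℤ.∣ i ℤ.^ e ℤ.- j ℤ.^ e
i-j∣i^e-j^e i j zero    = ℤ.divides (+ 0) (sym (*-zeroˡ (i ℤ.- j)))
i-j∣i^e-j^e i j (suc e) =
  subst (i ℤ.- j ℤ.∣_) (factor i j (i ℤ.^ e) (j ℤ.^ e))
    (ℤ.∣m∣n⇒∣m+n (ℤ.∣n⇒∣m*n i (i-j∣i^e-j^e i j e)) (ℤ.∣m⇒∣m*n (j ℤ.^ e) ℤ.∣-refl))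
  where
  factor : ∀ i j x y → i ℤ.* (x ℤ.- y) ℤ.+ (i ℤ.- j) ℤ.* y ≡ i ℤ.* x ℤ.- j ℤ.* y
  factor = solve-∀

n∣[n∸r]^e-[-r]^e : ∀ {n r} e → r ≤ n → + n ℤ.∣ + ((n ∸ r) ^ e) ℤ.- (- + r) ℤ.^ e
n∣[n∸r]^e-[-r]^e {n} {r} e r≤n =
  subst₂ ℤ._∣_ difference (cong (ℤ._- (- + r) ℤ.^ e) (sym (pos-^ (n ∸ r) e)))
    (i-j∣i^e-j^e (+ (n ∸ r)) (- + r) e)
  where
  difference : + (n ∸ r) ℤ.- (- + r) ≡ + n
  difference = begin
    + (n ∸ r) ℤ.+ - - + r ≡⟨ cong (ℤ._+_ (+ (n ∸ r))) (neg-involutive (+ r)) ⟩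
    + (n ∸ r) ℤ.+ + r     ≡⟨ sym (pos-+ (n ∸ r) r) ⟩
    + (n ∸ r + r)         ≡⟨ cong +_ (m∸n+n≡m r≤n) ⟩
    + n                   ∎
    where open ≡-Reasoning

-- Defs' congruence unfolds to a divisibility of ∣ + a - + b ∣, from which Agda
-- cannot recover a and b; hence the explicit arguments below.
module _ {n : ℕ} where

  private
    ≡-mod⇒∣ : ∀ a b → a ≡ b [mod n ] → + n ℤ.∣ + a ℤ.- + b
    ≡-mod⇒∣ a b = ∣ᵤ⇒∣

  ≡-mod-refl : ∀ a → a ≡ a [mod n ]
  ≡-mod-refl a = ∣⇒∣ᵤ (subst (+ n ℤ.∣_) (sym (+-inverseʳ (+ a))) (ℤ.divides (+ 0) refl))

  +-cong-mod : ∀ a b c d → a ≡ b [mod n ] → c ≡ d [mod n ] → (a + c) ≡ (b + d) [mod n ]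
  +-cong-mod a b c d a≡b c≡d = ∣⇒∣ᵤ (subst (+ n ℤ.∣_) difference-of-sums
    (ℤ.∣m∣n⇒∣m+n (≡-mod⇒∣ a b a≡b) (≡-mod⇒∣ c d c≡d)))
    where
    rearrange : ∀ w x y z → (w ℤ.- x) ℤ.+ (y ℤ.- z) ≡ (w ℤ.+ y) ℤ.- (x ℤ.+ z)
    rearrange = solve-∀
    difference-of-sums : (+ a ℤ.- + b) ℤ.+ (+ c ℤ.- + d) ≡ + (a + c) ℤ.- + (b + d)
    difference-of-sums =
      trans (rearrange (+ a) (+ b) (+ c) (+ d)) (sym (cong₂ ℤ._-_ (pos-+ a c) (pos-+ b d)))

  sum-map-cong-mod : ∀ (f g : ℕ → ℕ) {xs} → All (λ x → f x ≡ g x [mod n ]) xs →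
                     sum (map f xs) ≡ sum (map g xs) [mod n ]
  sum-map-cong-mod f g []                         = ≡-mod-refl 0
  sum-map-cong-mod f g {x ∷ xs} (fx≡gx ∷ fxs≡gxs) =
    +-cong-mod (f x) (g x) (sum (map f xs)) (sum (map g xs)) fx≡gx (sum-map-cong-mod f g fxs≡gxs)

  ≡-mod-⇔ : ∀ a b c → a ≡ b [mod n ] → (a ≡ c [mod n ] ⇔ b ≡ c [mod n ])
  ≡-mod-⇔ a b c a≡b = mk⇔
    (λ a≡c → ∣⇒∣ᵤ (subst (+ n ℤ.∣_) (shift-left (+ a) (+ b) (+ c))
      (ℤ.∣m∣n⇒∣m-n (≡-mod⇒∣ a c a≡c) (≡-mod⇒∣ a b a≡b))))
    (λ b≡c → ∣⇒∣ᵤ (subst (+ n ℤ.∣_) (shift-right (+ a) (+ b) (+ c))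
      (ℤ.∣m∣n⇒∣m+n (≡-mod⇒∣ a b a≡b) (≡-mod⇒∣ b c b≡c))))
    where
    shift-left : ∀ x y z → (x ℤ.- z) ℤ.- (x ℤ.- y) ≡ y ℤ.- z
    shift-left = solve-∀
    shift-right : ∀ x y z → (x ℤ.- y) ℤ.+ (y ℤ.- z) ≡ x ℤ.- z
    shift-right = solve-∀

  ∣-resp-≡-mod : ∀ a b → n ∣ a → a ≡ b [mod n ] → n ∣ b
  ∣-resp-≡-mod a b n∣a a≡b = ∣⇒∣ᵤ (ℤ.∣m+n∣m⇒∣n
    (subst (+ n ℤ.∣_) (sym (cancel (+ a) (+ b))) (∣ᵤ⇒∣ {i = + a} n∣a)) (≡-mod⇒∣ a b a≡b))
    where
    cancel : ∀ x y → (x ℤ.- y) ℤ.+ y ≡ x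
    cancel = solve-∀

[n∸r]^[k+k]≡r^[k+k] : ∀ {n r} k → r ≤ n → ((n ∸ r) ^ (k + k)) ≡ (r ^ (k + k)) [mod n ]
[n∸r]^[k+k]≡r^[k+k] {n} {r} k r≤n = ∣⇒∣ᵤ (subst (λ x → + n ℤ.∣ + ((n ∸ r) ^ (k + k)) ℤ.- x)
  (trans (neg-^-even (+ r) k) (sym (pos-^ r (k + k))))
  (n∣[n∸r]^e-[-r]^e (k + k) r≤n))

n∣[n∸r]^[1+k+k]+r^[1+k+k] : ∀ {n r} k → r ≤ n → n ∣ (n ∸ r) ^ suc (k + k) + r ^ suc (k + k)
n∣[n∸r]^[1+k+k]+r^[1+k+k] {n} {r} k r≤n = ∣⇒∣ᵤ (subst (+ n ℤ.∣_) sum-of-powers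
  (n∣[n∸r]^e-[-r]^e (suc (k + k)) r≤n))
  where
  e = suc (k + k)
  sum-of-powers : + ((n ∸ r) ^ e) ℤ.- (- + r) ℤ.^ e ≡ + ((n ∸ r) ^ e + r ^ e)
  sum-of-powers = begin
    + ((n ∸ r) ^ e) ℤ.- (- + r) ℤ.^ e   ≡⟨ cong (λ x → + ((n ∸ r) ^ e) ℤ.- x) (neg-^-odd (+ r) k) ⟩
    + ((n ∸ r) ^ e) ℤ.- - (+ r) ℤ.^ e   ≡⟨ cong (λ x → + ((n ∸ r) ^ e) ℤ.+ x) (neg-involutive ((+ r) ℤ.^ e)) ⟩
    + ((n ∸ r) ^ e) ℤ.+ (+ r) ℤ.^ e     ≡⟨ cong (ℤ._+_ (+ ((n ∸ r) ^ e))) (sym (pos-^ r e)) ⟩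
    + ((n ∸ r) ^ e) ℤ.+ + (r ^ e)       ≡⟨ sym (pos-+ ((n ∸ r) ^ e) (r ^ e)) ⟩
    + ((n ∸ r) ^ e + r ^ e)             ∎
    where open ≡-Reasoning

m*2≡m+m : ∀ m → m * 2 ≡ m + m
m*2≡m+m m = trans (*-comm m 2) (cong (_+_ m) (+-identityʳ m))

[m+m]/2≡m : ∀ m → (m + m) / 2 ≡ m
[m+m]/2≡m m = trans (cong (_/ 2) (sym (m*2≡m+m m))) (m*n/n≡m m 2)

applyUpTo-++ : ∀ {A : Set} (f : ℕ → A) m k → applyUpTo f (m + k) ≡ applyUpTo f m ++ applyUpTo (f ∘ _+_ m) k
applyUpTo-++ f zero    k = refl
applyUpTo-++ f (suc m) k = cong (f 0 ∷_) (applyUpTo-++ (f ∘ suc) m k)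

map-∸-applyUpTo : ∀ a b → map (suc (a + b) ∸_) (applyUpTo suc b) ≡ applyDownFrom (suc ∘ _+_ a) b
map-∸-applyUpTo a zero    = refl
map-∸-applyUpTo a (suc b) rewrite +-suc a b =
  cong (suc (a + b) ∷_) (trans (map-applyUpTo (suc ∘ suc) _ b)
    (trans (sym (map-applyUpTo suc _ b)) (map-∸-applyUpTo a b)))

take-length-++ : ∀ {A : Set} (xs ys : List A) → take (length xs) (xs ++ ys) ≡ xs
take-length-++ []       ys = refl
take-length-++ (x ∷ xs) ys = cong (x ∷_) (take-length-++ xs ys)

sum-map-+ : ∀ (f g : ℕ → ℕ) xs → sum (map (λ x → f x + g x) xs) ≡ sum (map f xs) + sum (map g xs)
sum-map-+ f g []       = refl
sum-map-+ f g (x ∷ xs) = trans (cong (_+_ (f x + g x)) (sum-map-+ f g xs))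
  (interchange (f x) (g x) (sum (map f xs)) (sum (map g xs)))

∣-sum : ∀ {d ns} → All (d ∣_) ns → d ∣ sum ns
∣-sum []           = divides 0 refl
∣-sum (d∣n ∷ d∣ns) = ∣m∣n⇒∣m+n d∣n (∣-sum d∣ns)

coprime? : ∀ n r → Dec (gcd r n ≡ 1)
coprime? n r = gcd r n ℕ.≟ 1

coprimeTo : ℕ → List ℕ → List ℕ
coprimeTo n = filter (coprime? n)

residuesUpTo : ℕ → ℕ → List ℕ
residuesUpTo n k = coprimeTo n (applyUpTo suc k)

gcd[m,m+n]≡gcd[m,n] : ∀ m n → gcd m (m + n) ≡ gcd m n
gcd[m,m+n]≡gcd[m,n] m n = GCD.unique (gcd-GCD m (m + n)) (GCD.step (gcd-GCD m n))

gcd[m,m*n]≡m : ∀ m n → gcd m (m * n) ≡ m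
gcd[m,m*n]≡m m n = GCD.unique (gcd-GCD m (m * n)) (GCD.is (∣-refl , m∣m*n n) proj₁)

gcd[n∸r,n]≡gcd[r,n] : ∀ {n r} → r ≤ n → gcd (n ∸ r) n ≡ gcd r n
gcd[n∸r,n]≡gcd[r,n] {n} {r} r≤n = begin
  gcd (n ∸ r) n             ≡⟨ cong (gcd (n ∸ r)) (sym (m∸n+n≡m r≤n)) ⟩
  gcd (n ∸ r) (n ∸ r + r)   ≡⟨ gcd[m,m+n]≡gcd[m,n] (n ∸ r) r ⟩
  gcd (n ∸ r) r             ≡⟨ gcd-comm (n ∸ r) r ⟩
  gcd r (n ∸ r)             ≡⟨ sym (gcd[m,m+n]≡gcd[m,n] r (n ∸ r)) ⟩
  gcd r (r + (n ∸ r))       ≡⟨ cong (gcd r) (m+[n∸m]≡n r≤n) ⟩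
  gcd r n                   ∎
  where open ≡-Reasoning

coprimeTo-map-∸ : ∀ {n xs} → All (_≤ n) xs → coprimeTo n (map (n ∸_) xs) ≡ map (n ∸_) (coprimeTo n xs)
coprimeTo-map-∸                  []          = refl
coprimeTo-map-∸ {n} {x ∷ xs} (x≤n ∷ xs≤n) with coprime? n x
... | yes coprime = begin
  coprimeTo n (n ∸ x ∷ map (n ∸_) xs)    ≡⟨ filter-accept (coprime? n) {n ∸ x} {map (n ∸_) xs} (trans (gcd[n∸r,n]≡gcd[r,n] x≤n) coprime) ⟩
  n ∸ x ∷ coprimeTo n (map (n ∸_) xs)    ≡⟨ cong (n ∸ x ∷_) (coprimeTo-map-∸ xs≤n) ⟩
  map (n ∸_) (x ∷ coprimeTo n xs)        ≡⟨ cong (map (n ∸_)) (filter-accept (coprime? n) {x} {xs} coprime) ⟨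
  map (n ∸_) (coprimeTo n (x ∷ xs))      ∎
  where open ≡-Reasoning
... | no ¬coprime = begin
  coprimeTo n (n ∸ x ∷ map (n ∸_) xs)    ≡⟨ filter-reject (coprime? n) {n ∸ x} {map (n ∸_) xs} (¬coprime ∘ trans (sym (gcd[n∸r,n]≡gcd[r,n] x≤n))) ⟩
  coprimeTo n (map (n ∸_) xs)            ≡⟨ coprimeTo-map-∸ xs≤n ⟩
  map (n ∸_) (coprimeTo n xs)            ≡⟨ cong (map (n ∸_)) (filter-reject (coprime? n) {x} {xs} ¬coprime) ⟨
  map (n ∸_) (coprimeTo n (x ∷ xs))      ∎
  where open ≡-Reasoning

residuesUpTo-≤ : ∀ {n k} → k ≤ n → All (_≤ n) (residuesUpTo n k)
residuesUpTo-≤ {n} {k} k≤n = filter⁺ (coprime? n) (applyUpTo⁺₁ suc k (λ i<k → ≤-trans i<k k≤n))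

coprimeTo-upper↭ : ∀ a b → let n = suc (a + b) in
  coprimeTo n (applyUpTo (suc ∘ _+_ a) b) ↭ map (n ∸_) (residuesUpTo n b)
coprimeTo-upper↭ a b = ↭-trans
  (filter-↭ (coprime? n) (↭-sym (↭-reverse (applyUpTo (suc ∘ _+_ a) b))))
  (↭-reflexive (begin
    coprimeTo n (reverse (applyUpTo (suc ∘ _+_ a) b))  ≡⟨ cong (coprimeTo n) (reverse-applyUpTo _ b) ⟩
    coprimeTo n (applyDownFrom (suc ∘ _+_ a) b)        ≡⟨ cong (coprimeTo n) (map-∸-applyUpTo a b) ⟨
    coprimeTo n (map (n ∸_) (applyUpTo suc b))         ≡⟨ coprimeTo-map-∸ (applyUpTo⁺₁ suc b b≤n) ⟩
    map (n ∸_) (residuesUpTo n b)                      ∎))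
  where
  n = suc (a + b)
  b≤n : ∀ {i} → i < b → suc i ≤ n
  b≤n i<b = ≤-trans i<b (≤-trans (m≤n+m b a) (n≤1+n (a + b)))
  open ≡-Reasoning

reducedResidues-++ : ∀ a b → let n = suc (a + b) in
  reducedResidues n ≡ residuesUpTo n a ++ coprimeTo n (applyUpTo (suc ∘ _+_ a) b)
reducedResidues-++ a b =
  trans (cong (coprimeTo n) (applyUpTo-++ suc a b)) (filter-++ (coprime? n) (applyUpTo suc a) _)
  where n = suc (a + b)

sum-reducedResidues : ∀ (f : ℕ → ℕ) a b → let n = suc (a + b) in
  sum (map f (reducedResidues n)) ≡ sum (map f (residuesUpTo n a)) + sum (map (f ∘ (n ∸_)) (residuesUpTo n b))
sum-reducedResidues f a b = begin
  sum (map f (reducedResidues n))                 ≡⟨ cong (sum ∘ map f) (reducedResidues-++ a b) ⟩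
  sum (map f (lower ++ upper))                    ≡⟨ cong sum (map-++ f lower upper) ⟩
  sum (map f lower ++ map f upper)                ≡⟨ sum-++ (map f lower) (map f upper) ⟩
  sum (map f lower) + sum (map f upper)           ≡⟨ cong (_+_ (sum (map f lower))) (sum-↭ (map⁺ f (coprimeTo-upper↭ a b))) ⟩
  sum (map f lower) + sum (map f (map (n ∸_) L))  ≡⟨ cong (λ xs → sum (map f lower) + sum xs) (map-∘ L) ⟨
  sum (map f lower) + sum (map (f ∘ (n ∸_)) L)    ∎
  where
  n = suc (a + b)
  lower = residuesUpTo n a
  upper = coprimeTo n (applyUpTo (suc ∘ _+_ a) b)
  L = residuesUpTo n b
  open ≡-Reasoning

residuesUpTo-suc : ∀ n k → gcd (suc k) n ≢ 1 → residuesUpTo n (suc k) ≡ residuesUpTo n k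
residuesUpTo-suc n k ¬coprime = begin
  coprimeTo n (applyUpTo suc (suc k))               ≡⟨ cong (coprimeTo n) (applyUpTo-∷ʳ suc k) ⟨
  coprimeTo n (applyUpTo suc k ++ [ suc k ])        ≡⟨ filter-++ (coprime? n) (applyUpTo suc k) [ suc k ] ⟩
  residuesUpTo n k ++ coprimeTo n [ suc k ]         ≡⟨ cong (residuesUpTo n k ++_) (filter-reject (coprime? n) {suc k} {[]} ¬coprime) ⟩
  residuesUpTo n k ++ []                            ≡⟨ ++-identityʳ _ ⟩
  residuesUpTo n k                                  ∎
  where open ≡-Reasoning

n∤φ[n] : ∀ m → ¬ (suc (suc m) ∣ φ (suc (suc m)))
n∤φ[n] m n∣φ = <⇒≱ φ<n (∣⇒≤ {{>-nonZero 0<φ}} n∣φ)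
  where
  n = suc (suc m)
  0<φ : 0 < φ n
  0<φ = subst (λ rs → 0 < length rs) (sym (filter-accept (coprime? n) {1} {applyUpTo (suc ∘ suc) m} (gcd-zeroˡ n))) z<s
  φ<n : φ n < n
  φ<n = s≤s (≤-trans (length-filter (coprime? n) (applyUpTo suc (suc m))) (≤-reflexive (length-applyUpTo suc (suc m))))

module Odd (k : ℕ) where

  open ≡-Reasoning

  n = suc (k + k)
  e = k + k
  L = residuesUpTo n k
  U = coprimeTo n (applyUpTo (suc ∘ _+_ k) k)

  half-length : length (L ++ U) / 2 ≡ length L
  half-length = begin
    length (L ++ U) / 2             ≡⟨ cong (_/ 2) (length-++ L) ⟩
    (length L + length U) / 2       ≡⟨ cong (λ m → (length L + m) / 2) (trans (↭-length (coprimeTo-upper↭ k k)) (length-map _ L)) ⟩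
    (length L + length L) / 2       ≡⟨ [m+m]/2≡m (length L) ⟩
    length L                        ∎

  halfSum≡2*sum-lower : halfSum n ≡ 2 * sum (map (_^ e) L)
  halfSum≡2*sum-lower = begin
    halfSum n                                                  ≡⟨ cong (λ rs → 2 * sum (map (_^ e) (take (length rs / 2) rs))) (reducedResidues-++ k k) ⟩
    2 * sum (map (_^ e) (take (length (L ++ U) / 2) (L ++ U))) ≡⟨ cong (λ m → 2 * sum (map (_^ e) (take m (L ++ U)))) half-length ⟩
    2 * sum (map (_^ e) (take (length L) (L ++ U)))            ≡⟨ cong (λ xs → 2 * sum (map (_^ e) xs)) (take-length-++ L U) ⟩
    2 * sum (map (_^ e) L)                                     ∎

  sum≡halfSum : sum (map (_^ e) (reducedResidues n)) ≡ halfSum n [mod n ]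
  sum≡halfSum = subst₂ (λ a b → a ≡ b [mod n ])
    (sym (sum-reducedResidues (_^ e) k k))
    (sym (trans halfSum≡2*sum-lower (cong (_+_ sA) (+-identityʳ sA))))
    (+-cong-mod sA sA sB sA (≡-mod-refl sA) sB≡sA)
    where
    sA = sum (map (_^ e) L)
    sB = sum (map ((_^ e) ∘ (n ∸_)) L)
    sB≡sA : sB ≡ sA [mod n ]
    sB≡sA = sum-map-cong-mod ((_^ e) ∘ (n ∸_)) (_^ e)
      (All.map ([n∸r]^[k+k]≡r^[k+k] k) (residuesUpTo-≤ (≤-trans (m≤m+n k k) (n≤1+n e))))

  weakCarmichael⇔ : Composite n → (WeakCarmichael n ⇔ (halfSum n ≡ φ n [mod n ]))
  weakCarmichael⇔ composite = mk⇔ (λ (_ , sum≡φ) → to sum≡φ) (λ halfSum≡φ → composite , from halfSum≡φ)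
    where open Equivalence (≡-mod-⇔ _ (halfSum n) (φ n) sum≡halfSum)

module Even (k : ℕ) where

  open ≡-Reasoning

  m = suc k
  n = suc (suc (m + m))
  e = suc (m + m)
  L = residuesUpTo n m

  ¬coprime : gcd (suc m) n ≢ 1
  ¬coprime coprime = contradiction (trans (sym gcd≡1+m) coprime) λ ()
    where
    gcd≡1+m : gcd (suc m) n ≡ suc m
    gcd≡1+m = subst (λ x → gcd (suc m) x ≡ suc m) (cong (suc ∘ suc) (m*2≡m+m m)) (gcd[m,m*n]≡m (suc m) 2)

  n∣sum : n ∣ sum (map (_^ e) (reducedResidues n))
  n∣sum = subst (n ∣_) (sym paired) (∣-sum (All.map⁺ (All.map (n∣[n∸r]^[1+k+k]+r^[1+k+k] m)
    (residuesUpTo-≤ (≤-trans (m≤m+n m m) (≤-trans (n≤1+n _) (n≤1+n _)))))))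
    where
    paired : sum (map (_^ e) (reducedResidues n)) ≡ sum (map (λ r → (n ∸ r) ^ e + r ^ e) L)
    paired = begin
      sum (map (_^ e) (reducedResidues n))                           ≡⟨ sum-reducedResidues (_^ e) (suc m) m ⟩
      sum (map (_^ e) (residuesUpTo n (suc m))) + sum (map ((_^ e) ∘ (n ∸_)) L)
                                                                     ≡⟨ cong (λ xs → sum (map (_^ e) xs) + sum (map ((_^ e) ∘ (n ∸_)) L)) (residuesUpTo-suc n m ¬coprime) ⟩
      sum (map (_^ e) L) + sum (map ((_^ e) ∘ (n ∸_)) L)             ≡⟨ +-comm (sum (map (_^ e) L)) _ ⟩
      sum (map ((_^ e) ∘ (n ∸_)) L) + sum (map (_^ e) L)             ≡⟨ sum-map-+ ((_^ e) ∘ (n ∸_)) (_^ e) L ⟨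
      sum (map (λ r → (n ∸ r) ^ e + r ^ e) L)                        ∎

  ¬weakCarmichael : ¬ WeakCarmichael n
  ¬weakCarmichael (_ , sum≡φ) = n∤φ[n] (m + m) (∣-resp-≡-mod _ (φ n) n∣sum sum≡φ)

¬weakCarmichael[2+k+k] : ∀ k → ¬ WeakCarmichael (suc (suc (k + k)))
¬weakCarmichael[2+k+k] zero    (composite , _) = prime⇒¬composite prime[2] composite
¬weakCarmichael[2+k+k] (suc k) = Even.¬weakCarmichael k

data Parity : ℕ → Set where
  zero : Parity 0
  odd  : ∀ k → Parity (suc (k + k))
  even : ∀ k → Parity (suc (suc (k + k)))

parity : ∀ n → Parity n
parity zero = zero
parity (suc n) with parity n
... | zero   = odd 0
... | odd k  = even k
... | even k = subst Parity (cong (suc ∘ suc) (+-suc k k)) (odd (suc k))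

2∤1+k+k : ∀ k → ¬ (2 ∣ suc (k + k))
2∤1+k+k k 2∣1+k+k with () ← ∣1⇒≡1 (∣m+n∣m⇒∣n (subst (2 ∣_) (+-comm 1 (k + k)) 2∣1+k+k) (divides k (sym (m*2≡m+m k))))

2∣2+k+k : ∀ k → 2 ∣ suc (suc (k + k))
2∣2+k+k k = divides (suc k) (cong (suc ∘ suc) (sym (m*2≡m+m k)))

proposition2p3 : ((n : ℕ) → WeakCarmichael n → ¬ (2 ∣ n))
    × ((n : ℕ) → Composite n → ¬ (2 ∣ n) → (WeakCarmichael n ⇔ (halfSum n ≡ φ n [mod n ])))
proposition2p3 = weakCarmichael⇒odd , odd⇒weakCarmichael⇔
  where
  weakCarmichael⇒odd : (n : ℕ) → WeakCarmichael n → ¬ (2 ∣ n)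
  weakCarmichael⇒odd n wc 2∣n with parity n
  ... | zero   = ¬composite[0] (proj₁ wc)
  ... | odd k  = 2∤1+k+k k 2∣n
  ... | even k = ¬weakCarmichael[2+k+k] k wc

  odd⇒weakCarmichael⇔ : (n : ℕ) → Composite n → ¬ (2 ∣ n) → (WeakCarmichael n ⇔ (halfSum n ≡ φ n [mod n ]))
  odd⇒weakCarmichael⇔ n composite 2∤n with parity n
  ... | zero   = contradiction composite ¬composite[0]
  ... | odd k  = Odd.weakCarmichael⇔ k composite
  ... | even k = contradiction (2∣2+k+k k) 2∤n
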